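{- Let $A$ be an alphabet of cardinality $\kappa\geq\omega$ and let $S$ be the free semigroup over $A$. Then there exists a finite coloring of $S$ such that for no variable word $w(v)$ over $A$ is the set $\{w(a): a\in A\}$ monochromatic.
   Context: The free semigroup $S$ over $A$ is the set of nonempty finite words over $A$ under concatenation. Let $v\notin A$ be a variable; a variable word over $A$ is a word $w(v)$ over $A\cup\{v\}$ in which $v$ occurs, and for $a\in A$, $w(a)$ is obtained by replacing every occurrence of $v$ by $a$. -}

module Defs where

open import Data.Nat using (ℕ)
open import Data.Fin using (Fin)
open import Data.Maybe using (Maybe; nothing; just; fromMaybe)
open import Data.List.NonEmpty using (List⁺; toList) renaming (map to map⁺)
open import Data.List.Membership.Propositional using (_∈_)
open import Data.Product using (Σ; proj₁)

FreeSemigroup : Set → Set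
FreeSemigroup A = List⁺ A

-- A variable word over A: a nonempty word over A ∪ {v}, where the variable v is
-- encoded as 'nothing' and a letter a ∈ A as 'just a', in which v occurs.
VarWord : Set → Set
VarWord A = Σ (List⁺ (Maybe A)) (λ u → nothing ∈ toList u)

_⟨_⟩ : {A : Set} → VarWord A → A → FreeSemigroup A
w ⟨ a ⟩ = map⁺ (fromMaybe a) (proj₁ w)

-- Colour a word x by the parity of the number of distinct letters of x and by whether x
-- begins with a fixed letter a₀. If a variable word w begins with a letter b, pick a letter
-- a not occurring in w(b) (A is infinite): the letters of w(a) are those of w(b) together
-- with a, so the parities differ. If w begins with the variable, w(a₀) and w(a₁) for any
-- a₁ ≠ a₀ differ in the second component.
module Submission where

open import Defs
open import Data.Nat using (ℕ)
open import Data.Fin using (Fin)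
open import Data.Product using (Σ)
open import Function.Bundles using (_↣_)
open import Relation.Nullary using (¬_)
open import Relation.Binary.PropositionalEquality using (_≡_)
open import Axiom.ExcludedMiddle using (ExcludedMiddle)
open import Level using (0ℓ)

open import Data.Nat using (zero; suc)
open import Data.Nat.Properties using (1+n≰n)
open import Data.Bool using (Bool; true; false; not)
open import Data.Bool.Properties using (not-¬)
open import Data.Fin using (toℕ)
open import Data.Fin.Properties using (toℕ-injective; injective⇒≤; 2↔Bool; *↔×)
open import Data.Maybe using (Maybe; just; nothing; fromMaybe)
open import Data.List using (List; []; _∷_; map; length; lookup; deduplicate)
open import Data.List.NonEmpty using (_∷_; toList; head)
open import Data.List.Relation.Unary.Any using (here; there; index)
open import Data.List.Relation.Unary.Any.Properties using (lookup-index)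
open import Data.List.Relation.Unary.All.Properties using (¬Any⇒All¬)
open import Data.List.Relation.Unary.Unique.DecPropositional.Properties using (deduplicate-!)
open import Data.List.Membership.Propositional using (_∈_; _∉_)
open import Data.List.Membership.Propositional.Properties
  using (∈-map⁺; ∈-map⁻; deduplicate-∈⇔)
open import Data.List.Membership.Propositional.Properties.WithK using (unique∧set⇒bag)
open import Data.List.Properties using (filter-all)
open import Data.List.Relation.Binary.BagAndSetEquality using (_∼[_]_; set; ∼bag⇒↭)
open import Data.List.Relation.Binary.Permutation.Propositional.Properties using (↭-length)
open import Data.Product using (_×_; _,_; proj₁; proj₂; ∃)
open import Data.Product.Function.NonDependent.Propositional using (_×-↔_)
open import Function using (_∘_; Injective)
open import Function.Bundles using (mk⇔; Equivalence; Injection)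
open import Function.Construct.Composition using (_⇔-∘_)
open import Function.Construct.Symmetry using (⇔-sym)
open import Function.Properties.Inverse using (↔-sym; ↔-trans; ↔⇒↣)
open import Relation.Nullary using (yes; no; ¬?; contradiction)
open import Relation.Nullary.Decidable using (does; dec-true; dec-false; decidable-stable)
open import Relation.Binary.Definitions using (DecidableEquality)
open import Relation.Binary.PropositionalEquality using (refl; trans; cong; module ≡-Reasoning)

substitute-∼ : ∀ {A : Set} {u : List (Maybe A)} {a b} → nothing ∈ u → just b ∈ u →
               map (fromMaybe a) u ∼[ set ] a ∷ map (fromMaybe b) u
substitute-∼ {u = u} {a} {b} v∈u b∈u = mk⇔ to from
  where
  to : ∀ {x} → x ∈ map (fromMaybe a) u → x ∈ a ∷ map (fromMaybe b) u
  to x∈ with ∈-map⁻ (fromMaybe a) x∈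
  ... | nothing , _   , refl = here refl
  ... | just c  , c∈u , refl = there (∈-map⁺ (fromMaybe b) c∈u)
  from : ∀ {x} → x ∈ a ∷ map (fromMaybe b) u → x ∈ map (fromMaybe a) u
  from (here refl) = ∈-map⁺ (fromMaybe a) v∈u
  from (there x∈) with ∈-map⁻ (fromMaybe b) x∈
  ... | nothing , _   , refl = ∈-map⁺ (fromMaybe a) b∈u
  ... | just c  , c∈u , refl = ∈-map⁺ (fromMaybe a) c∈u

module _ {A : Set} (_≟_ : DecidableEquality A) where

  distinct : List A → ℕ
  distinct xs = length (deduplicate _≟_ xs)

  distinct-cong : ∀ {xs ys} → xs ∼[ set ] ys → distinct xs ≡ distinct ys
  distinct-cong {xs} {ys} xs∼ys = ↭-length (∼bag⇒↭ (unique∧set⇒bag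
    (deduplicate-! _≟_ xs) (deduplicate-! _≟_ ys)
    (deduplicate-∈⇔ _≟_ ⇔-∘ (xs∼ys ⇔-∘ ⇔-sym (deduplicate-∈⇔ _≟_)))))

  distinct-∷-∉ : ∀ {x xs} → x ∉ xs → distinct (x ∷ xs) ≡ suc (distinct xs)
  distinct-∷-∉ {x} {xs} x∉xs = cong (suc ∘ length) (filter-all (λ y → ¬? (x ≟ y))
    (¬Any⇒All¬ _ (x∉xs ∘ Equivalence.from (deduplicate-∈⇔ _≟_))))

  distinct-substitute-fresh : ∀ (w : VarWord A) {a b} → just b ∈ toList (proj₁ w) →
    a ∉ toList (w ⟨ b ⟩) → distinct (toList (w ⟨ a ⟩)) ≡ suc (distinct (toList (w ⟨ b ⟩)))
  distinct-substitute-fresh (u , v∈u) b∈u a∉ =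
    trans (distinct-cong (substitute-∼ v∈u b∈u)) (distinct-∷-∉ a∉)

Inexhaustible : Set → Set
Inexhaustible A = (cs : List A) → ∃ λ a → a ∉ cs

↣⇒inexhaustible : ExcludedMiddle 0ℓ → {A : Set} → ℕ ↣ A → Inexhaustible A
↣⇒inexhaustible lem ι cs with lem {∃ λ a → a ∉ cs}
... | yes fresh = fresh
... | no ¬fresh = contradiction (injective⇒≤ position-injective) 1+n≰n
  where
  open Injection ι using (to; injective)
  covered : ∀ a → a ∈ cs
  covered a = decidable-stable lem (λ a∉cs → ¬fresh (a , a∉cs))
  position : Fin (suc (length cs)) → Fin (length cs)
  position i = index (covered (to (toℕ i)))
  position-injective : Injective _≡_ _≡_ position
  position-injective {i} {j} eq = toℕ-injective (injective (begin
    to (toℕ i)             ≡⟨ lookup-index (covered _) ⟩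
    lookup cs (position i) ≡⟨ cong (lookup cs) eq ⟩
    lookup cs (position j) ≡⟨ lookup-index (covered _) ⟨
    to (toℕ j)             ∎))
    where open ≡-Reasoning

odd : ℕ → Bool
odd zero    = false
odd (suc n) = not (odd n)

module Colouring {A : Set} (_≟_ : DecidableEquality A) (a₀ : A) where

  colour : FreeSemigroup A → Bool × Bool
  colour x = odd (distinct _≟_ (toList x)) , does (head x ≟ a₀)

  Monochromatic : VarWord A → Set
  Monochromatic w = ∀ a b → colour (w ⟨ a ⟩) ≡ colour (w ⟨ b ⟩)

  colour-rainbow : Inexhaustible A → (w : VarWord A) → ¬ Monochromatic w
  colour-rainbow fresh (nothing ∷ _ , _) mono = contradiction (begin
    true           ≡⟨ dec-true (a₀ ≟ a₀) refl ⟨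
    does (a₀ ≟ a₀) ≡⟨ cong proj₂ (mono a₀ a₁) ⟩
    does (a₁ ≟ a₀) ≡⟨ dec-false (a₁ ≟ a₀) (a₁∉[a₀] ∘ here) ⟩
    false          ∎) λ ()
    where
    open ≡-Reasoning
    a₁ : A
    a₁ = proj₁ (fresh (a₀ ∷ []))
    a₁∉[a₀] : a₁ ∉ a₀ ∷ []
    a₁∉[a₀] = proj₂ (fresh (a₀ ∷ []))
  colour-rainbow fresh w@(just b ∷ _ , _) mono = not-¬ refl (begin
    odd n                                 ≡⟨ cong proj₁ (mono a b) ⟨
    odd (distinct _≟_ (toList (w ⟨ a ⟩))) ≡⟨ cong odd (distinct-substitute-fresh _≟_ w (here refl) a∉) ⟩
    not (odd n)                           ∎)
    where
    open ≡-Reasoning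
    n : ℕ
    n = distinct _≟_ (toList (w ⟨ b ⟩))
    a : A
    a = proj₁ (fresh (toList (w ⟨ b ⟩)))
    a∉ : a ∉ toList (w ⟨ b ⟩)
    a∉ = proj₂ (fresh (toList (w ⟨ b ⟩)))

Bool²↣Fin4 : (Bool × Bool) ↣ Fin 4
Bool²↣Fin4 = ↔⇒↣ (↔-sym (↔-trans *↔× (2↔Bool ×-↔ 2↔Bool)))

theorem2p10 : ExcludedMiddle 0ℓ →
    (A : Set) → (ℕ ↣ A) →
    Σ ℕ (λ k → Σ (FreeSemigroup A → Fin k) (λ c →
      (w : VarWord A) → ¬ (∀ (a b : A) → c (w ⟨ a ⟩) ≡ c (w ⟨ b ⟩))))
theorem2p10 lem A ι = 4 , Injection.to Bool²↣Fin4 ∘ colour , λ w mono →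
  colour-rainbow fresh w (λ a b → Injection.injective Bool²↣Fin4 (mono a b))
  where
  fresh : Inexhaustible A
  fresh = ↣⇒inexhaustible lem ι
  open Colouring (λ x y → lem) (proj₁ (fresh []))
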